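{- No Sturmian sequence over the alphabet $\{ -1,1\}$ or over the alphabet $\{0,1\}$ is apwenian (in the $\pm1$ sense, respectively the $0$-$1$ sense).
   Context: A sequence over a two-letter alphabet is Sturmian if for every $n\geq 1$ it has exactly $n+1$ distinct factors (contiguous subwords) of length $n$. For an integer sequence $\mathbf{a}$, $H_n(\mathbf{a})=\det(a_{i+j})_{0\leq i,j\leq n-1}$. A sequence $\mathbf{d}\in\{ -1,1\}^{\infty}$ is apwenian if $H_n(\mathbf{d})/2^{n-1}\equiv 1\pmod 2$ for all $n\geq 1$; a sequence $\mathbf{c}\in\{0,1\}^{\infty}$ is apwenian if $H_n(\mathbf{c})\equiv 1\pmod 2$ for all $n\geq 1$. -}

module Defs where

open import Data.Nat as ℕ using (ℕ; zero; suc)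
open import Data.Integer as ℤ using (ℤ; +_; -_; _*_; _+_; -1ℤ; 0ℤ; 1ℤ)
open import Data.Fin using (Fin; zero; suc; toℕ; punchIn)
open import Data.Vec using (Vec; tabulate)
open import Data.Product using (Σ; ∃; _×_; _,_)
open import Data.Sum using (_⊎_)
open import Relation.Binary.PropositionalEquality using (_≡_)

-- Infinite sequences over ℤ (letters of the alphabets {-1,1} and {0,1} are integers).
Seq : Set
Seq = ℕ → ℤ

factor : Seq → ℕ → (n : ℕ) → Vec ℤ n
factor s i n = tabulate (λ k → s (i ℕ.+ toℕ k))

HasFactorCount : Seq → (n m : ℕ) → Set
HasFactorCount s n m =
  Σ (Fin m → Vec ℤ n) λ f →
    (∀ a b → f a ≡ f b → a ≡ b)
    × (∀ i → ∃ λ k → factor s i n ≡ f k)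
    × (∀ k → ∃ λ i → factor s i n ≡ f k)

-- Sturmian: exactly n+1 distinct factors of length n for every n ≥ 1.
Sturmian : Seq → Set
Sturmian s = ∀ n → HasFactorCount s (suc n) (suc (suc n))

sumFin : (n : ℕ) → (Fin n → ℤ) → ℤ
sumFin zero    f = 0ℤ
sumFin (suc n) f = f zero + sumFin n (λ j → f (suc j))

sign : ℕ → ℤ
sign zero    = 1ℤ
sign (suc k) = - sign k

det : (n : ℕ) → (Fin n → Fin n → ℤ) → ℤ
det zero    M = 1ℤ
det (suc n) M =
  sumFin (suc n) (λ j → sign (toℕ j) * M zero j
                          * det n (λ r c → M (suc r) (punchIn j c)))

hankel : Seq → ℕ → ℤ
hankel a n = det n (λ i j → a (toℕ i ℕ.+ toℕ j))

-- ±1 apwenian: H_n(d) / 2^(n-1) is odd for all n ≥ 1,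
-- i.e. H_n(d) = 2^(n-1) * (odd integer)
ApwenianPM : Seq → Set
ApwenianPM d = ∀ n → ∃ λ (k : ℤ) → hankel d (suc n) ≡ (+ (2 ℕ.^ n)) * (1ℤ + (+ 2) * k)

Apwenian01 : Seq → Set
Apwenian01 c = ∀ n → ∃ λ (k : ℤ) → hankel c (suc n) ≡ 1ℤ + (+ 2) * k

ValuesPM : Seq → Set
ValuesPM d = ∀ i → (d i ≡ -1ℤ) ⊎ (d i ≡ 1ℤ)

Values01 : Seq → Set
Values01 c = ∀ i → (c i ≡ 0ℤ) ⊎ (c i ≡ 1ℤ)

module Submission where

-- Both statements are refuted by a finite search over prefixes.
-- Two kinds of finite obstruction can be read off a prefix w of a sequence s:
--   * a Hankel obstruction: some H_{n+1}(w) (computable once |w| ≥ 2n+1) is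
--     divisible by 2·P n, whereas apwenian-ness says H_{n+1}(s) = P n · (odd),
--     with P n = 2^n in the ±1 case and P n = 1 in the 0-1 case;
--   * a factor obstruction: w already has k+3 distinct factors of length k+1,
--     whereas a Sturmian sequence has only k+2 of them (pigeonhole).
-- Both quantities only depend on a prefix of s.  A refutation tree over the
-- alphabet {x, y} extends the current prefix by x and by y until every branch
-- hits an obstruction; such a tree at the empty word rules out every Sturmian
-- apwenian sequence over {x, y}.

open import Defs
open import Data.Nat as ℕ using (ℕ; zero; suc; _≤_; _<_)
import Data.Nat.Properties as ℕP
import Data.Nat.Divisibility as ℕD
open import Data.Integer as ℤ using (ℤ; +_; _*_; _+_; -1ℤ; 0ℤ; 1ℤ)
import Data.Integer.Properties as ℤP
open import Data.Integer.Divisibility.Signed using (_∣_; _∣?_; ∣⇒∣ᵤ; ∣-refl; ∣m⇒∣m*n; ∣m+n∣n⇒∣m; *-cancelˡ-∣)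
open import Data.Fin as F using (Fin; toℕ; punchIn)
import Data.Fin.Properties as FP
import Data.Vec.Properties as VP
open import Data.List as L using (List; []; _∷_; length; _∷ʳ_)
open import Data.List.Properties using (length-++)
open import Data.Maybe as M using (Maybe; just; nothing; _<∣>_; from-just)
open import Data.Product using (∃; ∃₂; _×_; _,_; proj₁; proj₂)
open import Data.Sum using (_⊎_; inj₁; inj₂)
open import Data.Empty using (⊥)
open import Relation.Nullary using (¬_; Dec; yes; no; contradiction)
open import Relation.Nullary.Decidable using (_→-dec_)
open import Relation.Binary.PropositionalEquality

scaled-odd-not-even : ∀ p k .{{_ : ℤ.NonZero p}} → ¬ (p * + 2 ∣ p * (1ℤ + + 2 * k))
scaled-odd-not-even p k even = contradiction (ℕD.∣⇒≤ (∣⇒∣ᵤ two∣one)) 2≰1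
  where
  2≰1 : ¬ 2 ≤ 1
  2≰1 (ℕ.s≤s ())

  two∣one : + 2 ∣ 1ℤ
  two∣one = ∣m+n∣n⇒∣m (*-cancelˡ-∣ p even) (∣m⇒∣m*n k ∣-refl)

AgreeBelow : ℕ → Seq → Seq → Set
AgreeBelow N s t = ∀ i → i < N → s i ≡ t i

agreeBelow-mono : ∀ {M N s t} → M ≤ N → AgreeBelow N s t → AgreeBelow M s t
agreeBelow-mono M≤N agree i i<M = agree i (ℕP.<-≤-trans i<M M≤N)

sumFin-cong : ∀ n {f g : Fin n → ℤ} → (∀ i → f i ≡ g i) → sumFin n f ≡ sumFin n g
sumFin-cong zero    eq = refl
sumFin-cong (suc n) eq = cong₂ _+_ (eq F.zero) (sumFin-cong n (λ i → eq (F.suc i)))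

det-cong : ∀ n {M N : Fin n → Fin n → ℤ} → (∀ i j → M i j ≡ N i j) → det n M ≡ det n N
det-cong zero    eq = refl
det-cong (suc n) eq = sumFin-cong (suc n) λ j →
  cong₂ (λ a b → sign (toℕ j) * a * b) (eq F.zero j)
        (det-cong n (λ r c → eq (F.suc r) (punchIn j c)))

hankel-local : ∀ n {s t} → AgreeBelow (suc n ℕ.+ n) s t → hankel s (suc n) ≡ hankel t (suc n)
hankel-local n agree = det-cong (suc n) λ i j →
  agree _ (ℕP.+-mono-<-≤ (FP.toℕ<n i) (ℕP.≤-pred (FP.toℕ<n j)))

factor-local : ∀ p m {s t} → AgreeBelow (p ℕ.+ m) s t → factor s p m ≡ factor t p m
factor-local p m agree = VP.tabulate-cong λ k → agree _ (ℕP.+-monoʳ-< p (FP.toℕ<n k))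

-- A finite word read as a sequence (padded with zeros).
wordSeq : List ℤ → Seq
wordSeq []      i       = 0ℤ
wordSeq (a ∷ w) zero    = a
wordSeq (a ∷ w) (suc i) = wordSeq w i

BeginsWith : Seq → List ℤ → Set
BeginsWith s w = AgreeBelow (length w) s (wordSeq w)

wordSeq-∷ʳ-below : ∀ w x i → i < length w → wordSeq (w ∷ʳ x) i ≡ wordSeq w i
wordSeq-∷ʳ-below (a ∷ w) x zero    _         = refl
wordSeq-∷ʳ-below (a ∷ w) x (suc i) (ℕ.s≤s i<) = wordSeq-∷ʳ-below w x i i<

wordSeq-∷ʳ-last : ∀ w x → wordSeq (w ∷ʳ x) (length w) ≡ x
wordSeq-∷ʳ-last []      x = refl
wordSeq-∷ʳ-last (a ∷ w) x = wordSeq-∷ʳ-last w x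

beginsWith-∷ʳ : ∀ {s} w x → BeginsWith s w → s (length w) ≡ x → BeginsWith s (w ∷ʳ x)
beginsWith-∷ʳ w x prefix next i i<
  with ℕP.m<1+n⇒m<n∨m≡n (subst (i <_) (trans (length-++ w) (ℕP.+-comm (length w) 1)) i<)
... | inj₁ i<w    = trans (prefix i i<w) (sym (wordSeq-∷ʳ-below w x i i<w))
... | inj₂ refl   = trans next (sym (wordSeq-∷ʳ-last w x))

DistinctFactors : Seq → (m : ℕ) → ∀ {N} → (Fin N → ℕ) → Set
DistinctFactors s m pos = ∀ a b → factor s (pos a) m ≡ factor s (pos b) m → a ≡ b

-- A Sturmian sequence has only k+2 factors of length k+1, so it admits no
-- family of more than k+2 positions with pairwise distinct such factors.
sturmian-few-factors : ∀ {s N} k → Sturmian s → (pos : Fin N → ℕ) →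
                       suc (suc k) < N → ¬ DistinctFactors s (suc k) pos
sturmian-few-factors {s} k sturmian pos many distinct with sturmian k
... | f , _ , covered , _ = clash (FP.pigeonhole many index)
  where
  index : Fin _ → Fin (suc (suc k))
  index a = proj₁ (covered (pos a))

  clash : ∃₂ (λ a b → a F.< b × index a ≡ index b) → ⊥
  clash (a , b , a<b , same) = FP.<⇒≢ a<b (distinct a b (begin
    factor s (pos a) (suc k)  ≡⟨ proj₂ (covered (pos a)) ⟩
    f (index a)               ≡⟨ cong f same ⟩
    f (index b)               ≡⟨ proj₂ (covered (pos b)) ⟨
    factor s (pos b) (suc k)  ∎))
    where open ≡-Reasoning

-- The Hankel determinants of s are P n times an odd number; for P n = 2^n
-- this is the ±1 apwenian property, for P n = 1 the 0-1 one.
ScaledOddHankels : (ℕ → ℤ) → Seq → Set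
ScaledOddHankels P s = ∀ n → ∃ λ k → hankel s (suc n) ≡ P n * (1ℤ + + 2 * k)

data Obstruction (P : ℕ → ℤ) (w : List ℤ) : Set where
  evenHankel    : ∀ n → suc n ℕ.+ n ≤ length w →
                  P n * + 2 ∣ hankel (wordSeq w) (suc n) → Obstruction P w
  excessFactors : ∀ k (ps : List ℕ) → suc (suc k) < length ps →
                  (∀ a → L.lookup ps a ℕ.+ suc k ≤ length w) →
                  DistinctFactors (wordSeq w) (suc k) (L.lookup ps) → Obstruction P w

-- Soundness of obstructions: the determinant of w is that of s by locality,
-- and the factors of w at the chosen positions are those of s.
obstruction-sound : ∀ {P w s} → (∀ n → ℤ.NonZero (P n)) → Obstruction P w →
                    BeginsWith s w → Sturmian s → ¬ ScaledOddHankels P s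
obstruction-sound {P} {w} nonZero (evenHankel n fits even) prefix _ scaledOdd
  with scaledOdd n
... | k , hankel≡ = scaled-odd-not-even (P n) k {{nonZero n}} (subst (P n * + 2 ∣_) hankel-s even)
  where
  hankel-s : hankel (wordSeq w) (suc n) ≡ P n * (1ℤ + + 2 * k)
  hankel-s = trans (sym (hankel-local n (agreeBelow-mono fits prefix))) hankel≡
obstruction-sound {w = w} {s} _ (excessFactors k ps many fits distinct) prefix sturmian _ =
  sturmian-few-factors {s} k sturmian (L.lookup ps) many distinct-in-s
  where
  same-factor : ∀ a → factor s (L.lookup ps a) (suc k) ≡ factor (wordSeq w) (L.lookup ps a) (suc k)
  same-factor a = factor-local _ (suc k) (agreeBelow-mono (fits a) prefix)

  distinct-in-s : DistinctFactors s (suc k) (L.lookup ps)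
  distinct-in-s a b eq = distinct a b (trans (sym (same-factor a)) (trans eq (same-factor b)))

data Refutation (P : ℕ → ℤ) (x y : ℤ) (w : List ℤ) : Set where
  obstructed : Obstruction P w → Refutation P x y w
  branch     : Refutation P x y (w ∷ʳ x) → Refutation P x y (w ∷ʳ y) → Refutation P x y w

refutation-sound : ∀ {P x y w s} → (∀ n → ℤ.NonZero (P n)) → Refutation P x y w →
                   (∀ i → s i ≡ x ⊎ s i ≡ y) → BeginsWith s w →
                   Sturmian s → ¬ ScaledOddHankels P s
refutation-sound nonZero (obstructed o) _ prefix = obstruction-sound nonZero o prefix
refutation-sound {w = w} nonZero (branch onX onY) letters prefix with letters (length w)
... | inj₁ sₙ≡x = refutation-sound nonZero onX letters (beginsWith-∷ʳ w _ prefix sₙ≡x)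
... | inj₂ sₙ≡y = refutation-sound nonZero onY letters (beginsWith-∷ʳ w _ prefix sₙ≡y)

distinctFactors? : ∀ s m {N} (pos : Fin N → ℕ) → Dec (DistinctFactors s m pos)
distinctFactors? s m pos = FP.all? λ a → FP.all? λ b →
  VP.≡-dec ℤ._≟_ (factor s (pos a) m) (factor s (pos b) m) →-dec a F.≟ b

factorRepresentatives : List ℤ → ℕ → List ℕ
factorRepresentatives w m =
  L.deduplicate (λ p q → VP.≡-dec ℤ._≟_ (factor (wordSeq w) p m) (factor (wordSeq w) q m))
                (L.upTo (suc (length w ℕ.∸ m)))

findObstruction : (P : ℕ → ℤ) → (w : List ℤ) → Maybe (Obstruction P w)
findObstruction P w = first tryHankel <∣> first tryFactors
  where
  first : ∀ {A : Set} → (ℕ → Maybe A) → Maybe A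
  first try = L.head (L.mapMaybe try (L.upTo (length w)))

  tryHankel : ℕ → Maybe (Obstruction P w)
  tryHankel n with suc n ℕ.+ n ℕ.≤? length w
  ... | no _     = nothing
  ... | yes fits with P n * + 2 ∣? hankel (wordSeq w) (suc n)
  ...   | yes even = just (evenHankel n fits even)
  ...   | no _     = nothing

  tryFactors : ℕ → Maybe (Obstruction P w)
  tryFactors k = tryPositions (factorRepresentatives w (suc k))
    where
    tryPositions : List ℕ → Maybe (Obstruction P w)
    tryPositions ps with suc (suc k) ℕ.<? length ps
    ... | no _ = nothing
    ... | yes many with FP.all? (λ a → L.lookup ps a ℕ.+ suc k ℕ.≤? length w)
    ...   | no _ = nothing
    ...   | yes fits with distinctFactors? (wordSeq w) (suc k) (L.lookup ps)
    ...     | no _         = nothing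
    ...     | yes distinct = just (excessFactors k ps many fits distinct)

refute : (P : ℕ → ℤ) (x y : ℤ) → ℕ → (w : List ℤ) → Maybe (Refutation P x y w)
refute P x y zero    w = M.map obstructed (findObstruction P w)
refute P x y (suc d) w = M.map obstructed (findObstruction P w)
                     <∣> M.zipWith branch (refute P x y d (w ∷ʳ x)) (refute P x y d (w ∷ʳ y))

powerOfTwo : ℕ → ℤ
powerOfTwo n = + (2 ℕ.^ n)

powerOfTwo-nonZero : ∀ n → ℤ.NonZero (powerOfTwo n)
powerOfTwo-nonZero n = ℕP.m^n≢0 2 n

-- Refutation trees of depth 11 for both alphabets, found by evaluation.
pm-refutation : Refutation powerOfTwo -1ℤ 1ℤ []
pm-refutation = from-just (refute powerOfTwo -1ℤ 1ℤ 11 [])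

zeroOne-refutation : Refutation (λ _ → 1ℤ) 0ℤ 1ℤ []
zeroOne-refutation = from-just (refute (λ _ → 1ℤ) 0ℤ 1ℤ 11 [])

beginsWith-[] : ∀ s → BeginsWith s []
beginsWith-[] s i ()

proposition7p1 : ((d : Seq) → ValuesPM d → Sturmian d → ¬ ApwenianPM d)
                 × ((c : Seq) → Values01 c → Sturmian c → ¬ Apwenian01 c)
proposition7p1 = pm , zeroOne
  where
  pm : (d : Seq) → ValuesPM d → Sturmian d → ¬ ApwenianPM d
  pm d letters = refutation-sound powerOfTwo-nonZero pm-refutation letters (beginsWith-[] d)

  -- the 0-1 property is ScaledOddHankels with P n = 1, up to 1 * h = h;
  -- the instance argument (λ _ → _) records that 1 ≠ 0
  zeroOne : (c : Seq) → Values01 c → Sturmian c → ¬ Apwenian01 c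
  zeroOne c letters sturmian apwenian =
    refutation-sound (λ _ → _) zeroOne-refutation letters (beginsWith-[] c) sturmian
      λ n → let (k , odd) = apwenian n in k , trans odd (sym (ℤP.*-identityˡ _))
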